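{- There exist matrix spaces (over $\mathbb{R}$) spanned by projections (idempotent matrices) which are not in the Edmonds-Rado class, and there exist matrix spaces over $\mathbb{R}$ spanned by positive matrices (matrices all of whose entries are positive) which are not in the Edmonds-Rado class.
   Context: A matrix space $\mathcal{B}\leq M(n,\mathbb{F})$ is in the Edmonds-Rado class if either $\mathcal{B}$ contains a nonsingular matrix, or there exists a subspace $U\leq\mathbb{F}^n$ with $\dim U>\dim\mathcal{B}(U)$, where $\mathcal{B}(U)=\langle B(u):B\in\mathcal{B},u\in U\rangle$. -}

module Defs where

open import Level using (Level; _⊔_; Lift) renaming (suc to lsuc)
open import Algebra.Bundles using (CommutativeRing)
open import Data.Nat using (ℕ) renaming (_<_ to _<ℕ_)
open import Data.Fin using (Fin; zero; suc)
open import Data.Product using (Σ; ∃; ∃-syntax; _×_; _,_)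
open import Data.Sum using (_⊎_)
open import Relation.Nullary using (¬_)
open import Data.Fin using (_≟_)
open import Relation.Nullary using (yes; no)

-- The real numbers, axiomatised as a complete ordered field
-- (these axioms characterise ℝ up to isomorphism).  Equality is the
-- setoid equality _≈_ of the underlying commutative ring.

record RealField (c ℓ : Level) : Set (lsuc (c ⊔ ℓ)) where
  field
    commutativeRing : CommutativeRing c ℓ
  open CommutativeRing commutativeRing public
  infix 4 _<_ _≤_
  field
    _<_ : Carrier → Carrier → Set ℓ
  _≤_ : Carrier → Carrier → Set ℓ
  x ≤ y = x < y ⊎ x ≈ y
  field
    1≉0      : ¬ (1# ≈ 0#)
    inverse  : ∀ x → ¬ (x ≈ 0#) → ∃[ y ] (x * y ≈ 1#)
    <-irrefl : ∀ x → ¬ (x < x)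
    <-trans  : ∀ {x y z} → x < y → y < z → x < z
    <-resp-≈ : ∀ {x x' y y'} → x ≈ x' → y ≈ y' → x < y → x' < y'
    <-trichotomy : ∀ x y → (x < y) ⊎ (x ≈ y) ⊎ (y < x)
    +-mono-< : ∀ {x y} z → x < y → x + z < y + z
    *-pos    : ∀ {x y} → 0# < x → 0# < y → 0# < x * y
    complete : (S : Carrier → Set (c ⊔ ℓ)) →
               ∃[ x ] S x →
               ∃[ b ] (∀ x → S x → x ≤ b) →
               ∃[ s ] ((∀ x → S x → x ≤ s) ×
                       (∀ b → (∀ x → S x → x ≤ b) → s ≤ b))

module LinAlg {c ℓ : Level} (R : RealField c ℓ) where
  open RealField R hiding (zero)

  sumF : ∀ {k} → (Fin k → Carrier) → Carrier
  sumF {ℕ.zero}  f = 0#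
  sumF {ℕ.suc k} f = f zero + sumF (λ i → f (suc i))

  Vector : ℕ → Set c
  Vector n = Fin n → Carrier

  -- n × n matrices, M i j = entry in row i, column j
  Matrix : ℕ → Set c
  Matrix n = Fin n → Fin n → Carrier

  _≈ᵥ_ : ∀ {n} → Vector n → Vector n → Set ℓ
  u ≈ᵥ v = ∀ i → u i ≈ v i

  _≈ₘ_ : ∀ {n} → Matrix n → Matrix n → Set ℓ
  A ≈ₘ B = ∀ i j → A i j ≈ B i j

  _·ₘ_ : ∀ {n} → Matrix n → Matrix n → Matrix n
  (A ·ₘ B) i j = sumF (λ l → A i l * B l j)

  _·ᵥ_ : ∀ {n} → Matrix n → Vector n → Vector n
  (A ·ᵥ v) i = sumF (λ l → A i l * v l)

  identity : ∀ {n} → Matrix n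
  identity i j with i ≟ j
  ... | yes _ = 1#
  ... | no  _ = 0#

  combᵥ : ∀ {n k} → (Fin k → Carrier) → (Fin k → Vector n) → Vector n
  combᵥ a v i = sumF (λ j → a j * v j i)

  combₘ : ∀ {n k} → (Fin k → Carrier) → (Fin k → Matrix n) → Matrix n
  combₘ a M i j = sumF (λ l → a l * M l i j)

  zeroᵥ : ∀ {n} → Vector n
  zeroᵥ _ = 0#

  Idempotent : ∀ {n} → Matrix n → Set ℓ
  Idempotent P = (P ·ₘ P) ≈ₘ P

  Positive : ∀ {n} → Matrix n → Set ℓ
  Positive M = ∀ i j → 0# < M i j

  Nonsingular : ∀ {n} → Matrix n → Set (c ⊔ ℓ)
  Nonsingular {n} M = ∃[ N ] ((M ·ₘ N) ≈ₘ identity × (N ·ₘ M) ≈ₘ identity)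

  VSet : ℕ → Set (lsuc (c ⊔ ℓ))
  VSet n = Vector n → Set (c ⊔ ℓ)

  Span : ∀ {n} → VSet n → VSet n
  Span S v = ∃[ m ] Σ (Fin m → Vector _) λ w →
               (∀ j → S (w j)) × ∃[ a ] (v ≈ᵥ combᵥ a w)

  FamSet : ∀ {n m} → (Fin m → Vector n) → VSet n
  FamSet b w = Lift c (∃[ j ] (w ≈ᵥ b j))

  LinIndep : ∀ {n d} → (Fin d → Vector n) → Set (c ⊔ ℓ)
  LinIndep b = ∀ a → combᵥ a b ≈ᵥ zeroᵥ → ∀ j → a j ≈ 0#

  HasDim : ∀ {n} → VSet n → ℕ → Set (c ⊔ ℓ)
  HasDim V d = Σ (Fin d → Vector _) λ b →
                 (∀ j → V (b j)) × LinIndep b × (∀ v → V v → Span (FamSet b) v)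

  -- a matrix space 𝓑 ≤ M(n,F), given by a finite spanning family
  -- (every subspace of M(n,F) is of this form)
  MatSpace : ∀ {n k} → (Fin k → Matrix n) → Matrix n → Set (c ⊔ ℓ)
  MatSpace gens B = ∃[ a ] (B ≈ₘ combₘ a gens)

  SubSp : ∀ {n m} → (Fin m → Vector n) → VSet n
  SubSp u = Span (FamSet u)

  Image : ∀ {n k} → (Fin k → Matrix n) → VSet n → VSet n
  Image gens U = Span (λ v → ∃[ B ] ∃[ x ] (MatSpace gens B × U x × v ≈ᵥ (B ·ᵥ x)))

  EdmondsRado : ∀ {n k} → (Fin k → Matrix n) → Set (c ⊔ ℓ)
  EdmondsRado {n} gens =
    (∃[ B ] (MatSpace gens B × Nonsingular B))
    ⊎ (∃[ m ] Σ (Fin m → Vector n) λ u → ∃[ d ] ∃[ e ]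
         (HasDim (SubSp u) d × HasDim (Image gens (SubSp u)) e × e <ℕ d))

-- The space 𝓑 = { B(p) } of 4×4 matrices used here has an arbitrary first column a, while on
-- the hyperplane x₀ = 0 the matrix B(p) acts as x ↦ (x₃, -x₂, x₁) × q, a cross product with a
-- free vector q. No B(p) is invertible, since that cross product vanishes when (x₃, -x₂, x₁) = -q.
-- Yet 𝓑 enlarges no subspace U: if some x ∈ U has x₀ ≠ 0, then 𝓑(U) ⊇ x₀F⁴; otherwise U lies
-- in the hyperplane, dim U ≤ 3, a nonzero n admits some q with n × q ≠ 0, and for independent n, n′
-- the vectors m = n × n′, n × m, n′ × m are independent, their determinant being |m|⁴ > 0 (the one
-- place where the order of the field is used). The same holds for L𝓑 when L is invertible.
-- Finally, 𝓑 has a basis of idempotents B(p), and L𝓑 for L = I + 2J (J the all-ones matrix) a basis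
-- of entrywise positive matrices L B(p); both bases have integer parameters and are checked by
-- computation in ℤ.

module Submission where

open import Defs
open import Level using (Level; _⊔_; 0ℓ; lift)
open import Data.Empty using (⊥-elim)
open import Data.Nat as ℕ using (ℕ; zero; suc; z≤n; s≤s) renaming (_≤_ to _≤ℕ_)
import Data.Nat.Properties as ℕ
open import Data.Fin using (Fin; zero; suc; punchIn; _≟_; _↑ˡ_)
open import Data.Fin.Patterns using (0F; 1F; 2F; 3F; 4F; 5F; 6F)
open import Data.Fin.Properties using (all?; ¬∀⟶∃¬)
open import Data.Vec.Functional using ([]; _∷_; insertAt; removeAt)
open import Data.Vec.Functional.Properties using (insertAt-lookup; insertAt-punchIn)
open import Data.Integer as ℤ using (ℤ; +_; -[1+_]; _⊖_)
import Data.Integer.Properties as ℤ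
import Data.Nat.Literals
import Data.Integer.Literals
open import Data.Product using (Σ; ∃-syntax; _×_; _,_; proj₁; proj₂)
open import Data.Sum using (_⊎_; inj₁; inj₂)
open import Function using (_∘_)
open import Relation.Nullary using (¬_; yes; no; Dec)
open import Relation.Nullary.Decidable using (from-yes; dec⇒maybe)
open import Relation.Binary.PropositionalEquality as ≡ using (_≡_)
open import Algebra.Bundles.Raw using (RawRing)
open import Algebra.Solver.Ring.AlmostCommutativeRing
  using (_-Raw-AlmostCommutative⟶_; fromCommutativeRing)
import Data.Maybe as Maybe

data Entry : Set where
  0ₑ      : Entry
  +ₑ_ -ₑ_ : Fin 7 → Entry

-- B(p) for p = (a₀, a₁, a₂, a₃, q₀, q₁, q₂): a is the first column, q the cross-product vector.
shape : Fin 4 → Fin 4 → Entry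
shape = (+ₑ 0F ∷ -ₑ 5F ∷ -ₑ 6F ∷ 0ₑ    ∷ [])
      ∷ (+ₑ 1F ∷ +ₑ 4F ∷ 0ₑ    ∷ -ₑ 6F ∷ [])
      ∷ (+ₑ 2F ∷ 0ₑ    ∷ +ₑ 4F ∷ +ₑ 5F ∷ [])
      ∷ (+ₑ 3F ∷ 0ₑ    ∷ 0ₑ    ∷ 0ₑ    ∷ [])
      ∷ []

-- The formulas of the example over an arbitrary raw ring: they are used in the field, in ℤ
-- (to compute) and in the solver's expression language (to prove identities).
module Formulas {a ℓ} (A : RawRing a ℓ) where
  open RawRing A

  entry : (Fin 7 → Carrier) → Entry → Carrier
  entry p 0ₑ     = 0#
  entry p (+ₑ s) = p s
  entry p (-ₑ s) = - p s

  𝔹 : (Fin 7 → Carrier) → Fin 4 → Fin 4 → Carrier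
  𝔹 p i j = entry p (shape i j)

  infixr 7 _·₄_
  _·₄_ : (Fin 4 → Fin 4 → Carrier) → (Fin 4 → Carrier) → Fin 4 → Carrier
  (A ·₄ x) i = A i 0F * x 0F + (A i 1F * x 1F + (A i 2F * x 2F + (A i 3F * x 3F + 0#)))

  sum₄ : (Fin 4 → Carrier) → Carrier
  sum₄ x = x 0F + (x 1F + (x 2F + (x 3F + 0#)))

  params : (Fin 4 → Carrier) → (Fin 3 → Carrier) → Fin 7 → Carrier
  params a q = a 0F ∷ a 1F ∷ a 2F ∷ a 3F ∷ q 0F ∷ q 1F ∷ q 2F ∷ []

  dual : (Fin 4 → Carrier) → Fin 3 → Carrier
  dual x = x 3F ∷ - x 2F ∷ x 1F ∷ []

  ext : (Fin 3 → Carrier) → Fin 4 → Carrier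
  ext v = v 0F ∷ v 1F ∷ v 2F ∷ 0# ∷ []

  kernelVector : (Fin 7 → Carrier) → Fin 4 → Carrier
  kernelVector p = 0# ∷ - p 6F ∷ p 5F ∷ - p 4F ∷ []

  cross : (Fin 3 → Carrier) → (Fin 3 → Carrier) → Fin 3 → Carrier
  cross a b = a 1F * b 2F + - (a 2F * b 1F)
            ∷ a 2F * b 0F + - (a 0F * b 2F)
            ∷ a 0F * b 1F + - (a 1F * b 0F)
            ∷ []

  dot : (Fin 3 → Carrier) → (Fin 3 → Carrier) → Carrier
  dot a b = a 0F * b 0F + (a 1F * b 1F + (a 2F * b 2F + 0#))

  det : (Fin 3 → Carrier) → (Fin 3 → Carrier) → (Fin 3 → Carrier) → Carrier
  det u v w = dot u (cross v w)

  comb₃ : (Fin 3 → Carrier) → (Fin 3 → Carrier) → (Fin 3 → Carrier) → (Fin 3 → Carrier) → Fin 3 → Carrier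
  comb₃ k u v w i = k 0F * u i + (k 1F * v i + (k 2F * w i + 0#))

module ℤ-Matrices where
  open import Agda.Builtin.FromNat using (Number; fromNat)
  open import Agda.Builtin.FromNeg using (Negative; fromNeg)
  open import Data.Unit using (tt)
  open import Algebra.Definitions.RawMonoid ℤ.+-0-rawMonoid public using (sum)
  open Formulas ℤ.+-*-rawRing public using () renaming (𝔹 to 𝔹ℤ)

  private instance
    ℕ-number : Number ℕ
    ℕ-number = Data.Nat.Literals.number
    ℤ-number : Number ℤ
    ℤ-number = Data.Integer.Literals.number
    ℤ-negative : Negative ℤ
    ℤ-negative = Data.Integer.Literals.negative

  infixl 7 _⊗_
  _⊗_ : ∀ {m k n} → (Fin m → Fin k → ℤ) → (Fin k → Fin n → ℤ) → Fin m → Fin n → ℤ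
  (A ⊗ B) i j = sum (λ l → A i l ℤ.* B l j)

  idℤ : ∀ {n} → Fin n → Fin n → ℤ
  idℤ i j with i ≟ j
  ... | yes _ = 1
  ... | no  _ = 0

  Lℤ : Fin 4 → Fin 4 → ℤ
  Lℤ i j = 2 ℤ.+ idℤ i j

  -- The rows of C₁ (resp. C₂) are parameter vectors p with B(p) idempotent (resp. L B(p) positive);
  -- D₁ and D₂ are their inverses.
  C₁ D₁ C₂ D₂ : Fin 7 → Fin 7 → ℤ
  C₁ = (1 ∷ 0 ∷ 0 ∷ 0 ∷ 0 ∷  0 ∷  0 ∷ [])
     ∷ (1 ∷ 1 ∷ 0 ∷ 0 ∷ 0 ∷  0 ∷  0 ∷ [])
     ∷ (1 ∷ 0 ∷ 1 ∷ 0 ∷ 0 ∷  0 ∷  0 ∷ [])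
     ∷ (1 ∷ 0 ∷ 0 ∷ 1 ∷ 0 ∷  0 ∷  0 ∷ [])
     ∷ (0 ∷ 0 ∷ 0 ∷ 0 ∷ 1 ∷  0 ∷  0 ∷ [])
     ∷ (0 ∷ 0 ∷ 0 ∷ 0 ∷ 1 ∷ -1 ∷  0 ∷ [])
     ∷ (0 ∷ 0 ∷ 0 ∷ 0 ∷ 1 ∷  0 ∷ -1 ∷ [])
     ∷ []
  D₁ = ( 1 ∷ 0 ∷ 0 ∷ 0 ∷ 0 ∷  0 ∷  0 ∷ [])
     ∷ (-1 ∷ 1 ∷ 0 ∷ 0 ∷ 0 ∷  0 ∷  0 ∷ [])
     ∷ (-1 ∷ 0 ∷ 1 ∷ 0 ∷ 0 ∷  0 ∷  0 ∷ [])
     ∷ (-1 ∷ 0 ∷ 0 ∷ 1 ∷ 0 ∷  0 ∷  0 ∷ [])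
     ∷ ( 0 ∷ 0 ∷ 0 ∷ 0 ∷ 1 ∷  0 ∷  0 ∷ [])
     ∷ ( 0 ∷ 0 ∷ 0 ∷ 0 ∷ 1 ∷ -1 ∷  0 ∷ [])
     ∷ ( 0 ∷ 0 ∷ 0 ∷ 0 ∷ 1 ∷  0 ∷ -1 ∷ [])
     ∷ []
  C₂ = (1 ∷ 0 ∷ 0 ∷ 0 ∷ 1 ∷ -1 ∷ -2 ∷ [])
     ∷ (0 ∷ 1 ∷ 0 ∷ 0 ∷ 1 ∷ -1 ∷ -2 ∷ [])
     ∷ (0 ∷ 0 ∷ 1 ∷ 0 ∷ 1 ∷ -1 ∷ -2 ∷ [])
     ∷ (0 ∷ 0 ∷ 0 ∷ 1 ∷ 1 ∷ -1 ∷ -2 ∷ [])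
     ∷ (1 ∷ 0 ∷ 0 ∷ 0 ∷ 1 ∷ -1 ∷ -3 ∷ [])
     ∷ (1 ∷ 0 ∷ 0 ∷ 0 ∷ 2 ∷ -1 ∷ -2 ∷ [])
     ∷ (1 ∷ 0 ∷ 0 ∷ 0 ∷ 1 ∷ -2 ∷ -4 ∷ [])
     ∷ []
  D₂ = ( 3 ∷ 0 ∷ 0 ∷ 0 ∷ 0 ∷ -1 ∷ -1 ∷ [])
     ∷ ( 2 ∷ 1 ∷ 0 ∷ 0 ∷ 0 ∷ -1 ∷ -1 ∷ [])
     ∷ ( 2 ∷ 0 ∷ 1 ∷ 0 ∷ 0 ∷ -1 ∷ -1 ∷ [])
     ∷ ( 2 ∷ 0 ∷ 0 ∷ 1 ∷ 0 ∷ -1 ∷ -1 ∷ [])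
     ∷ (-1 ∷ 0 ∷ 0 ∷ 0 ∷ 0 ∷  1 ∷  0 ∷ [])
     ∷ (-1 ∷ 0 ∷ 0 ∷ 0 ∷ 2 ∷  0 ∷ -1 ∷ [])
     ∷ ( 1 ∷ 0 ∷ 0 ∷ 0 ∷ -1 ∷ 0 ∷  0 ∷ [])
     ∷ []

  D₁C₁≡I : ∀ u s → (D₁ ⊗ C₁) u s ≡ idℤ u s
  D₁C₁≡I = from-yes (all? λ u → all? λ s → (D₁ ⊗ C₁) u s ℤ.≟ idℤ u s)

  D₂C₂≡I : ∀ u s → (D₂ ⊗ C₂) u s ≡ idℤ u s
  D₂C₂≡I = from-yes (all? λ u → all? λ s → (D₂ ⊗ C₂) u s ℤ.≟ idℤ u s)

  C₁-idempotent : ∀ t i j → (𝔹ℤ (C₁ t) ⊗ 𝔹ℤ (C₁ t)) i j ≡ 𝔹ℤ (C₁ t) i j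
  C₁-idempotent = from-yes (all? λ t → all? λ i → all? λ j →
    (𝔹ℤ (C₁ t) ⊗ 𝔹ℤ (C₁ t)) i j ℤ.≟ 𝔹ℤ (C₁ t) i j)

  C₂-positive : ∀ t i j → 0 ℤ.< (Lℤ ⊗ 𝔹ℤ (C₂ t)) i j
  C₂-positive = from-yes (all? λ t → all? λ i → all? λ j → 0 ℤ.<? (Lℤ ⊗ 𝔹ℤ (C₂ t)) i j)

module ℤ-Embedding {c ℓ : Level} (R : RealField c ℓ) where
  open RealField R hiding (zero)
  open import Algebra.Definitions.RawMonoid +-rawMonoid using (_×′_)
  open import Algebra.Properties.Monoid.Mult.TCOptimised +-monoid using (×-homo-+)
  open import Algebra.Properties.Semiring.Mult.TCOptimised semiring using (×1-homo-*)
  open import Algebra.Properties.Group +-group using (ε⁻¹≈ε; ⁻¹-involutive)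
  open import Algebra.Properties.AbelianGroup +-abelianGroup using (⁻¹-∙-comm)
  open import Algebra.Properties.CommutativeSemigroup +-commutativeSemigroup using (interchange)
  open import Algebra.Properties.Ring ring using (-‿distribˡ-*; -‿distribʳ-*)
  open import Relation.Binary.Reasoning.Setoid setoid

  ι : ℤ → Carrier
  ι (+ n)    = n ×′ 1#
  ι -[1+ n ] = - (suc n ×′ 1#)

  private
    ν : ℕ → Carrier
    ν n = n ×′ 1#

    ν-suc : ∀ n → ν (suc n) ≈ 1# + ν n
    ν-suc n = ×-homo-+ 1# 1 n

    ι-⊖ : ∀ m n → ι (m ⊖ n) ≈ ν m + - ν n
    ι-⊖ m       zero    = sym (trans (+-congˡ ε⁻¹≈ε) (+-identityʳ _))
    ι-⊖ zero    (suc n) = sym (+-identityˡ _)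
    ι-⊖ (suc m) (suc n) = begin
      ι (suc m ⊖ suc n)               ≡⟨ ≡.cong ι (ℤ.[1+m]⊖[1+n]≡m⊖n m n) ⟩
      ι (m ⊖ n)                       ≈⟨ ι-⊖ m n ⟩
      ν m + - ν n                     ≈⟨ +-identityˡ _ ⟨
      0# + (ν m + - ν n)              ≈⟨ +-congʳ (-‿inverseʳ 1#) ⟨
      (1# + - 1#) + (ν m + - ν n)     ≈⟨ interchange _ _ _ _ ⟩
      (1# + ν m) + (- 1# + - ν n)     ≈⟨ +-cong (sym (ν-suc m)) (⁻¹-∙-comm 1# (ν n)) ⟩
      ν (suc m) + - (1# + ν n)        ≈⟨ +-congˡ (-‿cong (sym (ν-suc n))) ⟩
      ν (suc m) + - ν (suc n)         ∎

  ι-+ : ∀ i j → ι (i ℤ.+ j) ≈ ι i + ι j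
  ι-+ (+ m)    (+ n)    = ×-homo-+ 1# m n
  ι-+ (+ m)    -[1+ n ] = ι-⊖ m (suc n)
  ι-+ -[1+ m ] (+ n)    = trans (ι-⊖ n (suc m)) (+-comm _ _)
  ι-+ -[1+ m ] -[1+ n ] = begin
    - ν (suc (suc (m ℕ.+ n)))       ≡⟨ ≡.cong (λ k → - ν (suc k)) (ℕ.+-suc m n) ⟨
    - ν (suc m ℕ.+ suc n)           ≈⟨ -‿cong (×-homo-+ 1# (suc m) (suc n)) ⟩
    - (ν (suc m) + ν (suc n))       ≈⟨ ⁻¹-∙-comm _ _ ⟨
    - ν (suc m) + - ν (suc n)       ∎

  ι-neg : ∀ i → ι (ℤ.- i) ≈ - ι i
  ι-neg (+ zero)  = sym ε⁻¹≈ε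
  ι-neg (+ suc n) = refl
  ι-neg -[1+ n ]  = sym (⁻¹-involutive _)

  private
    ι-*-pos : ∀ m j → ι (+ m ℤ.* j) ≈ ν m * ι j
    ι-*-pos m (+ n)    = trans (reflexive (≡.cong ι (ℤ.+◃n≡+n (m ℕ.* n)))) (×1-homo-* m n)
    ι-*-pos m -[1+ n ] = begin
      ι (+ m ℤ.* -[1+ n ])          ≡⟨ ≡.cong ι (ℤ.neg-distribʳ-* (+ m) (+ suc n)) ⟨
      ι (ℤ.- (+ m ℤ.* + suc n))     ≈⟨ ι-neg (+ m ℤ.* + suc n) ⟩
      - ι (+ m ℤ.* + suc n)         ≈⟨ -‿cong (ι-*-pos m (+ suc n)) ⟩
      - (ν m * ν (suc n))           ≈⟨ -‿distribʳ-* _ _ ⟩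
      ν m * - ν (suc n)             ∎

  ι-* : ∀ i j → ι (i ℤ.* j) ≈ ι i * ι j
  ι-* (+ m)    j = ι-*-pos m j
  ι-* -[1+ m ] j = begin
    ι (-[1+ m ] ℤ.* j)           ≡⟨ ≡.cong ι (ℤ.neg-distribˡ-* (+ suc m) j) ⟨
    ι (ℤ.- (+ suc m ℤ.* j))      ≈⟨ ι-neg (+ suc m ℤ.* j) ⟩
    - ι (+ suc m ℤ.* j)          ≈⟨ -‿cong (ι-*-pos (suc m) j) ⟩
    - (ν (suc m) * ι j)          ≈⟨ -‿distribˡ-* _ _ ⟩
    - ν (suc m) * ι j            ∎

  ι-homomorphism : ℤ.+-*-rawRing -Raw-AlmostCommutative⟶ fromCommutativeRing commutativeRing
  ι-homomorphism = record
    { ⟦_⟧ = ι ; +-homo = ι-+ ; *-homo = ι-* ; -‿homo = ι-neg ; 0-homo = refl ; 1-homo = refl }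

  -- The ring solver with integer coefficients; equal coefficients are recognised
  -- through the decidable equality of ℤ.
  open import Algebra.Solver.Ring ℤ.+-*-rawRing (fromCommutativeRing commutativeRing) ι-homomorphism
    (λ i j → Maybe.map (reflexive ∘ ≡.cong ι) (dec⇒maybe (i ℤ.≟ j)))
    public using (Polynomial; solve; _:=_; con; _:+_; _:*_; :-_)

  expressions : ℕ → RawRing 0ℓ 0ℓ
  expressions m = record
    { Carrier = Polynomial m ; _≈_ = _≡_ ; _+_ = _:+_ ; _*_ = _:*_ ; -_ = :-_ ; 0# = con (+ 0) ; 1# = con (+ 1) }

  module E {m} = Formulas (expressions m)

module OrderedField {c ℓ : Level} (R : RealField c ℓ) where
  open RealField R hiding (zero)
  open ℤ-Embedding R
  open import Algebra.Properties.Group +-group using (ε⁻¹≈ε; ⁻¹-involutive)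
  open import Relation.Binary.Reasoning.Setoid setoid

  0<⇒≉0 : ∀ {x} → 0# < x → ¬ x ≈ 0#
  0<⇒≉0 0<x x≈0 = <-irrefl 0# (<-resp-≈ refl x≈0 0<x)

  ≈0? : ∀ x → Dec (x ≈ 0#)
  ≈0? x with <-trichotomy x 0#
  ... | inj₁ x<0        = no λ x≈0 → <-irrefl 0# (<-resp-≈ x≈0 refl x<0)
  ... | inj₂ (inj₁ x≈0) = yes x≈0
  ... | inj₂ (inj₂ 0<x) = no (0<⇒≉0 0<x)

  *-cancelˡ-≉0 : ∀ {x y} → ¬ x ≈ 0# → x * y ≈ 0# → y ≈ 0#
  *-cancelˡ-≉0 {x} {y} x≉0 xy≈0 = begin
    y              ≈⟨ *-identityˡ y ⟨
    1# * y         ≈⟨ *-congʳ x⁻¹x≈1 ⟨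
    (x⁻¹ * x) * y  ≈⟨ *-assoc x⁻¹ x y ⟩
    x⁻¹ * (x * y)  ≈⟨ *-congˡ xy≈0 ⟩
    x⁻¹ * 0#       ≈⟨ zeroʳ x⁻¹ ⟩
    0#             ∎
    where
    x⁻¹ = proj₁ (inverse x x≉0)
    x⁻¹x≈1 = trans (*-comm x⁻¹ x) (proj₂ (inverse x x≉0))

  neg-pos : ∀ {x} → x < 0# → 0# < - x
  neg-pos {x} x<0 = <-resp-≈ (-‿inverseʳ x) (+-identityˡ (- x)) (+-mono-< (- x) x<0)

  0<1 : 0# < 1#
  0<1 with <-trichotomy 0# 1#
  ... | inj₁ 0<1        = 0<1
  ... | inj₂ (inj₁ 0≈1) = ⊥-elim (1≉0 (sym 0≈1))
  ... | inj₂ (inj₂ 1<0) = ⊥-elim (<-irrefl 1# (<-trans 1<0 (<-resp-≈ refl 1*1≈1 (*-pos 0<-1 0<-1))))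
    where
    0<-1 = neg-pos 1<0
    1*1≈1 = solve 0 (:- con (+ 1) :* :- con (+ 1) := con (+ 1)) refl

  0<+ : ∀ {x y} → 0# < x → 0# ≤ y → 0# < x + y
  0<+ {x} {y} 0<x (inj₁ 0<y) = <-trans 0<y (<-resp-≈ (+-identityˡ y) refl (+-mono-< y 0<x))
  0<+ {x} {y} 0<x (inj₂ 0≈y) = <-resp-≈ refl (trans (sym (+-identityʳ x)) (+-congˡ 0≈y)) 0<x

  0≤+ : ∀ {x y} → 0# ≤ x → 0# ≤ y → 0# ≤ x + y
  0≤+ (inj₁ 0<x) 0≤y = inj₁ (0<+ 0<x 0≤y)
  0≤+ {x} {y} (inj₂ 0≈x) 0≤y = Data.Sum.map (<-resp-≈ refl y≈x+y) (λ 0≈y → trans 0≈y y≈x+y) 0≤y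
    where y≈x+y = trans (sym (+-identityˡ y)) (+-congʳ 0≈x)

  0<x² : ∀ {x} → ¬ x ≈ 0# → 0# < x * x
  0<x² {x} x≉0 with <-trichotomy x 0#
  ... | inj₁ x<0        = <-resp-≈ refl (solve 1 (λ x → :- x :* :- x := x :* x) refl x)
                                   (*-pos (neg-pos x<0) (neg-pos x<0))
  ... | inj₂ (inj₁ x≈0) = ⊥-elim (x≉0 x≈0)
  ... | inj₂ (inj₂ 0<x) = *-pos 0<x 0<x

  0≤x² : ∀ x → 0# ≤ x * x
  0≤x² x with ≈0? x
  ... | yes x≈0 = inj₂ (sym (trans (*-congʳ x≈0) (zeroˡ x)))
  ... | no x≉0  = inj₁ (0<x² x≉0)

  -x≈0⇒x≈0 : ∀ {x} → - x ≈ 0# → x ≈ 0#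
  -x≈0⇒x≈0 {x} -x≈0 = trans (sym (⁻¹-involutive x)) (trans (-‿cong -x≈0) ε⁻¹≈ε)

  0<ι : ∀ {i} → + 0 ℤ.< i → 0# < ι i
  0<ι {+ zero}  (ℤ.+<+ ())
  0<ι {+ suc n} _ = go n
    where
    go : ∀ n → 0# < ι (+ suc n)
    go zero    = 0<1
    go (suc n) = <-resp-≈ refl (+-comm _ _) (0<+ 0<1 (inj₁ (go n)))

  nonzero-or-zero : ∀ {k} (f : Fin k → Carrier) → (∃[ j ] ¬ f j ≈ 0#) ⊎ (∀ j → f j ≈ 0#)
  nonzero-or-zero {k} f with all? (λ j → ≈0? (f j))
  ... | yes f≈0 = inj₂ f≈0
  ... | no  f≉0 = inj₁ (¬∀⟶∃¬ k (λ j → f j ≈ 0#) (λ j → ≈0? (f j)) f≉0)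

module Summation {c ℓ : Level} (R : RealField c ℓ) where
  open RealField R hiding (zero)
  open LinAlg R
  open OrderedField R
  open import Algebra.Properties.Semiring.Sum semiring
    using (sum; sum-cong-≋; sum-replicate-zero; *-distribˡ-sum; *-distribʳ-sum; ∑-distrib-+; ∑-comm; sum-remove)
  open import Algebra.Properties.Ring ring using (-1*x≈-x)
  open import Relation.Binary.Reasoning.Setoid setoid

  sumF≡sum : ∀ {k} (f : Fin k → Carrier) → sumF f ≡ sum f
  sumF≡sum {zero}  f = ≡.refl
  sumF≡sum {suc k} f = ≡.cong (_+_ (f zero)) (sumF≡sum (f ∘ suc))

  sumF-cong : ∀ {k} {f g : Fin k → Carrier} → (∀ i → f i ≈ g i) → sumF f ≈ sumF g
  sumF-cong {f = f} {g} f≈g = begin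
    sumF f ≡⟨ sumF≡sum f ⟩
    sum f  ≈⟨ sum-cong-≋ f≈g ⟩
    sum g  ≡⟨ sumF≡sum g ⟨
    sumF g ∎

  sumF-zero : ∀ {k} {f : Fin k → Carrier} → (∀ i → f i ≈ 0#) → sumF f ≈ 0#
  sumF-zero {k} f≈0 =
    trans (sumF-cong {g = λ _ → 0#} f≈0) (trans (reflexive (sumF≡sum {k} (λ _ → 0#))) (sum-replicate-zero k))

  *-distribˡ-sumF : ∀ {k} x (f : Fin k → Carrier) → x * sumF f ≈ sumF (λ i → x * f i)
  *-distribˡ-sumF x f = begin
    x * sumF f             ≡⟨ ≡.cong (x *_) (sumF≡sum f) ⟩
    x * sum f              ≈⟨ *-distribˡ-sum x f ⟩
    sum (λ i → x * f i)    ≡⟨ sumF≡sum (λ i → x * f i) ⟨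
    sumF (λ i → x * f i)   ∎

  *-distribʳ-sumF : ∀ {k} x (f : Fin k → Carrier) → sumF f * x ≈ sumF (λ i → f i * x)
  *-distribʳ-sumF x f = begin
    sumF f * x             ≡⟨ ≡.cong (_* x) (sumF≡sum f) ⟩
    sum f * x              ≈⟨ *-distribʳ-sum x f ⟩
    sum (λ i → f i * x)    ≡⟨ sumF≡sum (λ i → f i * x) ⟨
    sumF (λ i → f i * x)   ∎

  sumF-distrib-+ : ∀ {k} (f g : Fin k → Carrier) → sumF (λ i → f i + g i) ≈ sumF f + sumF g
  sumF-distrib-+ f g = begin
    sumF (λ i → f i + g i) ≡⟨ sumF≡sum (λ i → f i + g i) ⟩
    sum (λ i → f i + g i)  ≈⟨ ∑-distrib-+ f g ⟩
    sum f + sum g          ≡⟨ ≡.cong₂ _+_ (sumF≡sum f) (sumF≡sum g) ⟨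
    sumF f + sumF g        ∎

  -‿distrib-sumF : ∀ {k} (f : Fin k → Carrier) → - sumF f ≈ sumF (λ i → - f i)
  -‿distrib-sumF f = begin
    - sumF f                    ≈⟨ -1*x≈-x (sumF f) ⟨
    - 1# * sumF f               ≈⟨ *-distribˡ-sumF (- 1#) f ⟩
    sumF (λ i → - 1# * f i)     ≈⟨ sumF-cong (λ i → -1*x≈-x (f i)) ⟩
    sumF (λ i → - f i)          ∎

  sumF-comm : ∀ {k m} (f : Fin k → Fin m → Carrier) →
              sumF (λ i → sumF (f i)) ≈ sumF (λ j → sumF (λ i → f i j))
  sumF-comm f = begin
    sumF (λ i → sumF (f i))            ≡⟨ sumF≡sum (λ i → sumF (f i)) ⟩
    sum (λ i → sumF (f i))             ≈⟨ sum-cong-≋ (λ i → reflexive (sumF≡sum (f i))) ⟩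
    sum (λ i → sum (f i))              ≈⟨ ∑-comm f ⟩
    sum (λ j → sum (λ i → f i j))      ≈⟨ sum-cong-≋ (λ j → reflexive (sumF≡sum (λ i → f i j))) ⟨
    sum (λ j → sumF (λ i → f i j))     ≡⟨ sumF≡sum (λ j → sumF (λ i → f i j)) ⟨
    sumF (λ j → sumF (λ i → f i j))    ∎

  sumF-remove : ∀ {k} (i : Fin (suc k)) (f : Fin (suc k) → Carrier) → sumF f ≈ f i + sumF (removeAt f i)
  sumF-remove i f = begin
    sumF f                    ≡⟨ sumF≡sum f ⟩
    sum f                     ≈⟨ sum-remove {i = i} f ⟩
    f i + sum (removeAt f i)  ≡⟨ ≡.cong (_+_ (f i)) (sumF≡sum (removeAt f i)) ⟨
    f i + sumF (removeAt f i) ∎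

  identity-suc : ∀ {n} (i j : Fin n) → identity (suc i) (suc j) ≡ identity i j
  identity-suc i j with i ≟ j
  ... | yes _ = ≡.refl
  ... | no  _ = ≡.refl

  identity-sym : ∀ {n} (i j : Fin n) → identity i j ≡ identity j i
  identity-sym zero    zero    = ≡.refl
  identity-sym zero    (suc j) = ≡.refl
  identity-sym (suc i) zero    = ≡.refl
  identity-sym (suc i) (suc j) = ≡.trans (identity-suc i j) (≡.trans (identity-sym i j) (≡.sym (identity-suc j i)))

  identity-refl : ∀ {n} (i : Fin n) → identity i i ≡ 1#
  identity-refl zero    = ≡.refl
  identity-refl (suc i) = ≡.trans (identity-suc i i) (identity-refl i)

  sumF-identityˡ : ∀ {n} (i : Fin n) (f : Fin n → Carrier) → sumF (λ j → identity i j * f j) ≈ f i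
  sumF-identityˡ {suc n} zero f = begin
    1# * f zero + sumF (λ j → 0# * f (suc j))
      ≈⟨ +-cong (*-identityˡ _) (sumF-zero {n} (λ j → zeroˡ (f (suc j)))) ⟩
    f zero + 0#
      ≈⟨ +-identityʳ _ ⟩
    f zero ∎
  sumF-identityˡ {suc n} (suc i) f = begin
    0# * f zero + sumF (λ j → identity (suc i) (suc j) * f (suc j))
      ≈⟨ +-cong (zeroˡ _) (sumF-cong (λ j → *-congʳ (reflexive (identity-suc i j)))) ⟩
    0# + sumF (λ j → identity i j * f (suc j))
      ≈⟨ +-identityˡ _ ⟩
    sumF (λ j → identity i j * f (suc j))
      ≈⟨ sumF-identityˡ i (f ∘ suc) ⟩
    f (suc i) ∎

  sumF-identityʳ : ∀ {n} (i : Fin n) (f : Fin n → Carrier) → sumF (λ j → f j * identity j i) ≈ f i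
  sumF-identityʳ i f =
    trans (sumF-cong (λ j → trans (*-comm _ _) (*-congʳ (reflexive (identity-sym j i))))) (sumF-identityˡ i f)

  sumF-nonneg : ∀ {k} (f : Fin k → Carrier) → (∀ i → 0# ≤ f i) → 0# ≤ sumF f
  sumF-nonneg {zero}  f _   = inj₂ refl
  sumF-nonneg {suc k} f 0≤f = 0≤+ (0≤f zero) (sumF-nonneg (f ∘ suc) (0≤f ∘ suc))

  sumF-pos : ∀ {k} (f : Fin k → Carrier) → (∀ i → 0# ≤ f i) → ∀ j → 0# < f j → 0# < sumF f
  sumF-pos f 0≤f zero    0<f₀ = 0<+ 0<f₀ (sumF-nonneg (f ∘ suc) (0≤f ∘ suc))
  sumF-pos f 0≤f (suc j) 0<fⱼ =
    <-resp-≈ refl (+-comm _ _) (0<+ (sumF-pos (f ∘ suc) (0≤f ∘ suc) j 0<fⱼ) (0≤f zero))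

module LinearAlgebra {c ℓ : Level} (R : RealField c ℓ) where
  open RealField R hiding (zero)
  open LinAlg R
  open ℤ-Embedding R
  open OrderedField R
  open Summation R
  open import Algebra.Properties.CommutativeSemigroup *-commutativeSemigroup using (x∙yz≈y∙xz)
  open import Relation.Binary.Reasoning.Setoid setoid

  ·ᵥ-congˡ : ∀ {n} {A B : Matrix n} (v : Vector n) → A ≈ₘ B → (A ·ᵥ v) ≈ᵥ (B ·ᵥ v)
  ·ᵥ-congˡ v A≈B i = sumF-cong (λ l → *-congʳ (A≈B i l))

  ·ᵥ-congʳ : ∀ {n} (A : Matrix n) {u v : Vector n} → u ≈ᵥ v → (A ·ᵥ u) ≈ᵥ (A ·ᵥ v)
  ·ᵥ-congʳ A u≈v i = sumF-cong (λ l → *-congˡ (u≈v l))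

  ·ᵥ-zeroʳ : ∀ {n} (A : Matrix n) → (A ·ᵥ zeroᵥ) ≈ᵥ zeroᵥ
  ·ᵥ-zeroʳ A i = sumF-zero (λ l → zeroʳ (A i l))

  identity-·ᵥ : ∀ {n} (v : Vector n) → (identity ·ᵥ v) ≈ᵥ v
  identity-·ᵥ v i = sumF-identityˡ i v

  identity-·ₘ : ∀ {n} (A : Matrix n) → (identity ·ₘ A) ≈ₘ A
  identity-·ₘ A i j = sumF-identityˡ i (λ l → A l j)

  ·ₘ-·ᵥ-assoc : ∀ {n} (A B : Matrix n) (v : Vector n) → ((A ·ₘ B) ·ᵥ v) ≈ᵥ (A ·ᵥ (B ·ᵥ v))
  ·ₘ-·ᵥ-assoc A B v i = begin
    sumF (λ j → sumF (λ l → A i l * B l j) * v j)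
      ≈⟨ sumF-cong (λ j → *-distribʳ-sumF (v j) (λ l → A i l * B l j)) ⟩
    sumF (λ j → sumF (λ l → A i l * B l j * v j))
      ≈⟨ sumF-comm (λ j l → A i l * B l j * v j) ⟩
    sumF (λ l → sumF (λ j → A i l * B l j * v j))
      ≈⟨ sumF-cong (λ l → sumF-cong (λ j → *-assoc (A i l) (B l j) (v j))) ⟩
    sumF (λ l → sumF (λ j → A i l * (B l j * v j)))
      ≈⟨ sumF-cong (λ l → *-distribˡ-sumF (A i l) (λ j → B l j * v j)) ⟨
    sumF (λ l → A i l * sumF (λ j → B l j * v j)) ∎

  combᵥ-assoc : ∀ {n k m} (a : Fin k → Carrier) (b : Fin k → Fin m → Carrier) (u : Fin m → Vector n) →
                combᵥ (λ t → sumF (λ j → a j * b j t)) u ≈ᵥ combᵥ a (λ j → combᵥ (b j) u)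
  combᵥ-assoc a b u i = begin
    sumF (λ t → sumF (λ j → a j * b j t) * u t i)
      ≈⟨ sumF-cong (λ t → *-distribʳ-sumF (u t i) (λ j → a j * b j t)) ⟩
    sumF (λ t → sumF (λ j → a j * b j t * u t i))
      ≈⟨ sumF-comm (λ t j → a j * b j t * u t i) ⟩
    sumF (λ j → sumF (λ t → a j * b j t * u t i))
      ≈⟨ sumF-cong (λ j → sumF-cong (λ t → *-assoc (a j) (b j t) (u t i))) ⟩
    sumF (λ j → sumF (λ t → a j * (b j t * u t i)))
      ≈⟨ sumF-cong (λ j → *-distribˡ-sumF (a j) (λ t → b j t * u t i)) ⟨
    sumF (λ j → a j * sumF (λ t → b j t * u t i)) ∎

  ·ᵥ-combᵥ : ∀ {n k} (A : Matrix n) (a : Fin k → Carrier) (f : Fin k → Vector n) →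
             (A ·ᵥ combᵥ a f) ≈ᵥ combᵥ a (λ j → A ·ᵥ f j)
  ·ᵥ-combᵥ A a f i = begin
    sumF (λ l → A i l * sumF (λ j → a j * f j l))
      ≈⟨ sumF-cong (λ l → *-distribˡ-sumF (A i l) (λ j → a j * f j l)) ⟩
    sumF (λ l → sumF (λ j → A i l * (a j * f j l)))
      ≈⟨ sumF-comm (λ l j → A i l * (a j * f j l)) ⟩
    sumF (λ j → sumF (λ l → A i l * (a j * f j l)))
      ≈⟨ sumF-cong (λ j → sumF-cong (λ l → x∙yz≈y∙xz (A i l) (a j) (f j l))) ⟩
    sumF (λ j → sumF (λ l → a j * (A i l * f j l)))
      ≈⟨ sumF-cong (λ j → *-distribˡ-sumF (a j) (λ l → A i l * f j l)) ⟨
    sumF (λ j → a j * sumF (λ l → A i l * f j l)) ∎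

  ·ₘ-congʳ : ∀ {n} (A : Matrix n) {B B′ : Matrix n} → B ≈ₘ B′ → (A ·ₘ B) ≈ₘ (A ·ₘ B′)
  ·ₘ-congʳ A B≈B′ i j = ·ᵥ-congʳ A (λ l → B≈B′ l j) i

  combₘ-congʳ : ∀ {n k} (a : Fin k → Carrier) {M M′ : Fin k → Matrix n} →
                (∀ t → M t ≈ₘ M′ t) → combₘ a M ≈ₘ combₘ a M′
  combₘ-congʳ a M≈M′ i j = sumF-cong (λ t → *-congˡ (M≈M′ t i j))

  ·ₘ-combₘ : ∀ {n k} (A : Matrix n) (a : Fin k → Carrier) (M : Fin k → Matrix n) →
             (A ·ₘ combₘ a M) ≈ₘ combₘ a (λ t → A ·ₘ M t)
  ·ₘ-combₘ A a M i j = ·ᵥ-combᵥ A a (λ t l → M t l j) i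

  TrivialKernel : ∀ {n} → Matrix n → Set (c ⊔ ℓ)
  TrivialKernel A = ∀ v → (A ·ᵥ v) ≈ᵥ zeroᵥ → v ≈ᵥ zeroᵥ

  Nonsingular⇒TrivialKernel : ∀ {n} {B : Matrix n} → Nonsingular B → TrivialKernel B
  Nonsingular⇒TrivialKernel {B = B} (N , _ , NB≈I) v Bv≈0 i = begin
    v i                   ≈⟨ identity-·ᵥ v i ⟨
    (identity ·ᵥ v) i     ≈⟨ ·ᵥ-congˡ v NB≈I i ⟨
    ((N ·ₘ B) ·ᵥ v) i     ≈⟨ ·ₘ-·ᵥ-assoc N B v i ⟩
    (N ·ᵥ (B ·ᵥ v)) i     ≈⟨ ·ᵥ-congʳ N Bv≈0 i ⟩
    (N ·ᵥ zeroᵥ) i        ≈⟨ ·ᵥ-zeroʳ N i ⟩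
    0#                    ∎

  identity-TrivialKernel : ∀ {n} → TrivialKernel (identity {n})
  identity-TrivialKernel v Iv≈0 i = trans (sym (identity-·ᵥ v i)) (Iv≈0 i)

  TrivialKernel-resp : ∀ {n} {A B : Matrix n} → A ≈ₘ B → TrivialKernel A → TrivialKernel B
  TrivialKernel-resp A≈B ker-A v Bv≈0 = ker-A v (λ i → trans (·ᵥ-congˡ v A≈B i) (Bv≈0 i))

  TrivialKernel-·ₘ : ∀ {n} {A B : Matrix n} → TrivialKernel (A ·ₘ B) → TrivialKernel B
  TrivialKernel-·ₘ {A = A} {B} ker-AB v Bv≈0 =
    ker-AB v (λ i → trans (·ₘ-·ᵥ-assoc A B v i) (trans (·ᵥ-congʳ A Bv≈0 i) (·ᵥ-zeroʳ A i)))

  LinIndep-resp : ∀ {n d} {f g : Fin d → Vector n} → (∀ j → f j ≈ᵥ g j) → LinIndep f → LinIndep g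
  LinIndep-resp f≈g ind a comb≈0 = ind a (λ i → trans (sumF-cong (λ j → *-congˡ (f≈g j i))) (comb≈0 i))

  LinIndep-map : ∀ {n d} {A : Matrix n} {f : Fin d → Vector n} →
                 TrivialKernel A → LinIndep f → LinIndep (λ j → A ·ᵥ f j)
  LinIndep-map {A = A} {f} ker-A ind a comb≈0 =
    ind a (ker-A (combᵥ a f) (λ i → trans (·ᵥ-combᵥ A a f i) (comb≈0 i)))

  LinIndep-scale : ∀ {n d} {x : Carrier} {f : Fin d → Vector n} →
                   ¬ x ≈ 0# → LinIndep f → LinIndep (λ j i → x * f j i)
  LinIndep-scale {x = x} {f} x≉0 ind a comb≈0 j =
    *-cancelˡ-≉0 x≉0 (trans (*-comm x (a j)) (ind (λ j → a j * x) comb'≈0 j))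
    where
    comb'≈0 : combᵥ (λ j → a j * x) f ≈ᵥ zeroᵥ
    comb'≈0 i = trans (sumF-cong (λ j → *-assoc (a j) x (f j i))) (comb≈0 i)

  identity-LinIndep : ∀ {n} → LinIndep (identity {n})
  identity-LinIndep a comb≈0 i = trans (sym (sumF-identityʳ i a)) (comb≈0 i)

  LinIndep⇒≉0 : ∀ {n d} {f : Fin d → Vector n} → LinIndep f → ∀ j → ¬ f j ≈ᵥ zeroᵥ
  LinIndep⇒≉0 {f = f} ind j fⱼ≈0 =
    1≉0 (trans (reflexive (≡.sym (identity-refl j)))
               (ind (identity j) (λ i → trans (sumF-identityˡ j (λ t → f t i)) (fⱼ≈0 i)) j))

  LinIndep-singleton : ∀ {n} {v : Vector n} → ¬ v ≈ᵥ zeroᵥ → LinIndep (λ (_ : Fin 1) → v)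
  LinIndep-singleton {v = v} v≉0 a comb≈0 zero with nonzero-or-zero v
  ... | inj₁ (i , vᵢ≉0) =
    *-cancelˡ-≉0 vᵢ≉0 (trans (*-comm (v i) (a zero)) (trans (sym (+-identityʳ _)) (comb≈0 i)))
  ... | inj₂ v≈0        = ⊥-elim (v≉0 v≈0)

  LinIndep-first₂ : ∀ {n d} {f : Fin (suc (suc d)) → Vector n} →
                    LinIndep f → LinIndep (λ (j : Fin 2) → f (j ↑ˡ d))
  LinIndep-first₂ {d = d} {f} ind a comb≈0 =
    λ { zero → ind a′ comb′≈0 zero ; (suc zero) → ind a′ comb′≈0 (suc zero) }
    where
    a′ : Fin (suc (suc d)) → Carrier
    a′ zero          = a zero
    a′ (suc zero)    = a (suc zero)
    a′ (suc (suc _)) = 0#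
    comb′≈0 : combᵥ a′ f ≈ᵥ zeroᵥ
    comb′≈0 i = trans (+-congˡ (+-congˡ (sumF-zero (λ t → zeroˡ (f (suc (suc t)) i))))) (comb≈0 i)

  ∈⇒Span : ∀ {n} {S : VSet n} {v : Vector n} → S v → Span S v
  ∈⇒Span {v = v} v∈S =
    1 , (λ _ → v) , (λ _ → v∈S) , (λ _ → 1#) , λ i → sym (trans (+-identityʳ _) (*-identityˡ (v i)))

  combᵥ∈Span : ∀ {n m} (u : Fin m → Vector n) {v : Vector n} (a : Fin m → Carrier) →
               v ≈ᵥ combᵥ a u → Span (FamSet u) v
  combᵥ∈Span {m = m} u a v≈au = m , u , (λ t → lift (t , λ i → refl)) , a , v≈au

  identity-spans : ∀ {n} (v : Vector n) → Span (FamSet identity) v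
  identity-spans v = combᵥ∈Span identity v (λ i → sym (sumF-identityʳ i v))

  hyperplane-combᵥ : ∀ {n} {v : Vector (suc n)} → v zero ≈ 0# → v ≈ᵥ combᵥ (v ∘ suc) (identity ∘ suc)
  hyperplane-combᵥ {v = v} v₀≈0 i = begin
    v i
      ≈⟨ sumF-identityʳ i v ⟨
    v zero * identity zero i + combᵥ (v ∘ suc) (identity ∘ suc) i
      ≈⟨ +-congʳ (trans (*-congʳ v₀≈0) (zeroˡ _)) ⟩
    0# + combᵥ (v ∘ suc) (identity ∘ suc) i
      ≈⟨ +-identityˡ _ ⟩
    combᵥ (v ∘ suc) (identity ∘ suc) i ∎

  Span-coordinates : ∀ {n m} (u : Fin m → Vector n) {v : Vector n} →
                     Span (FamSet u) v → ∃[ a ] v ≈ᵥ combᵥ a u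
  Span-coordinates u {v} (_ , w , w∈u , b , v≈bw) = (λ t → sumF (λ j → b j * identity (index j) t)) , λ i → begin
    v i
      ≈⟨ v≈bw i ⟩
    combᵥ b w i
      ≈⟨ sumF-cong (λ j → *-congˡ (trans (w≈u j i) (sym (sumF-identityˡ (index j) (λ t → u t i))))) ⟩
    combᵥ b (λ j → combᵥ (identity (index j)) u) i
      ≈⟨ combᵥ-assoc b (λ j → identity (index j)) u i ⟨
    combᵥ (λ t → sumF (λ j → b j * identity (index j) t)) u i ∎
    where
    index = λ j → proj₁ (Level.lower (w∈u j))
    w≈u   = λ j → proj₂ (Level.lower (w∈u j))

  LinIndep-tail : ∀ {e d} {v : Fin d → Vector (suc e)} →
                  (∀ j → v j zero ≈ 0#) → LinIndep v → LinIndep (λ j i → v j (suc i))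
  LinIndep-tail {v = v} v₀≈0 ind a comb≈0 = ind a λ
    { zero    → sumF-zero (λ j → trans (*-congˡ (v₀≈0 j)) (zeroʳ (a j)))
    ; (suc i) → comb≈0 i }

  -- Gaussian elimination of the first coordinate, with the vector v j₀ as pivot.
  rowReduce : ∀ {e d} → (Fin (suc d) → Vector e) → Fin (suc d) → Fin e → Fin d → Vector e
  rowReduce v j₀ k j i = v j₀ k * v (punchIn j₀ j) i + - (v (punchIn j₀ j) k * v j₀ i)

  LinIndep-rowReduce : ∀ {e d} (v : Fin (suc d) → Vector (suc e)) (j₀ : Fin (suc d)) → ¬ v j₀ zero ≈ 0# →
                       LinIndep v → LinIndep (λ j i → rowReduce v j₀ zero j (suc i))
  LinIndep-rowReduce v j₀ p≉0 ind a comb≈0 j = *-cancelˡ-≉0 p≉0 (begin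
    p * a j        ≡⟨ insertAt-punchIn (λ j → p * a j) j₀ (- S) j ⟨
    a′ (punchIn j₀ j) ≈⟨ ind a′ comb′≈0 (punchIn j₀ j) ⟩
    0#             ∎)
    where
    p = v j₀ zero
    w = rowReduce v j₀ zero
    S = sumF (λ j → a j * v (punchIn j₀ j) zero)
    a′ = insertAt (λ j → p * a j) j₀ (- S)
    comb′≈comb : ∀ i → combᵥ a′ v i ≈ combᵥ a w i
    comb′≈comb i = begin
      combᵥ a′ v i
        ≈⟨ sumF-remove j₀ (λ t → a′ t * v t i) ⟩
      a′ j₀ * v j₀ i + sumF (λ j → a′ (punchIn j₀ j) * v (punchIn j₀ j) i)
        ≈⟨ +-cong (*-congʳ (reflexive (insertAt-lookup (λ j → p * a j) j₀ (- S))))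
                  (sumF-cong (λ j → *-congʳ (reflexive (insertAt-punchIn (λ j → p * a j) j₀ (- S) j)))) ⟩
      - S * x + sumF (λ j → (p * a j) * y j)
        ≈⟨ solve 3 (λ s x t → :- s :* x :+ t := t :+ :- (s :* x)) refl S x _ ⟩
      sumF (λ j → (p * a j) * y j) + - (S * x)
        ≈⟨ +-congˡ (-‿cong (*-distribʳ-sumF x (λ j → a j * z j))) ⟩
      sumF (λ j → (p * a j) * y j) + - sumF (λ j → a j * z j * x)
        ≈⟨ +-congˡ (-‿distrib-sumF (λ j → a j * z j * x)) ⟩
      sumF (λ j → (p * a j) * y j) + sumF (λ j → - (a j * z j * x))
        ≈⟨ sumF-distrib-+ (λ j → (p * a j) * y j) (λ j → - (a j * z j * x)) ⟨
      sumF (λ j → (p * a j) * y j + - (a j * z j * x))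
        ≈⟨ sumF-cong (λ j → solve 5 (λ p a y z x → (p :* a) :* y :+ :- (a :* z :* x) := a :* (p :* y :+ :- (z :* x)))
                                    refl p (a j) (y j) (z j) x) ⟩
      combᵥ a w i ∎
      where
      x = v j₀ i
      y = λ j → v (punchIn j₀ j) i
      z = λ j → v (punchIn j₀ j) zero
    comb′≈0 : combᵥ a′ v ≈ᵥ zeroᵥ
    comb′≈0 zero    = trans (comb′≈comb zero) (sumF-zero (λ j →
      solve 3 (λ a p x → a :* (p :* x :+ :- (x :* p)) := con (+ 0)) refl (a j) p (v (punchIn j₀ j) zero)))
    comb′≈0 (suc i) = trans (comb′≈comb (suc i)) (comb≈0 i)

  LinIndep⇒≤ : ∀ {e d} (v : Fin d → Vector e) → LinIndep v → d ≤ℕ e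
  LinIndep⇒≤ {_}     {zero}  v ind = z≤n
  LinIndep⇒≤ {zero}  {suc d} v ind = ⊥-elim (1≉0 (ind (λ _ → 1#) (λ ()) zero))
  LinIndep⇒≤ {suc e} {suc d} v ind with nonzero-or-zero (λ j → v j zero)
  ... | inj₂ v₀≈0       =
    ℕ.m≤n⇒m≤1+n (LinIndep⇒≤ (λ j i → v j (suc i)) (LinIndep-tail {v = v} v₀≈0 ind))
  ... | inj₁ (j₀ , p≉0) =
    s≤s (LinIndep⇒≤ (λ j i → rowReduce v j₀ zero j (suc i)) (LinIndep-rowReduce v j₀ p≉0 ind))

  LinIndep-Span-≤ : ∀ {n m d} (u : Fin m → Vector n) (v : Fin d → Vector n) →
                    (∀ j → Span (FamSet u) (v j)) → LinIndep v → d ≤ℕ m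
  LinIndep-Span-≤ u v v∈⟨u⟩ ind = LinIndep⇒≤ coords coords-LinIndep
    where
    coords = λ j → proj₁ (Span-coordinates u (v∈⟨u⟩ j))
    coords-LinIndep : LinIndep coords
    coords-LinIndep a comb≈0 = ind a λ i → begin
      combᵥ a v i
        ≈⟨ sumF-cong (λ j → *-congˡ (proj₂ (Span-coordinates u (v∈⟨u⟩ j)) i)) ⟩
      combᵥ a (λ j → combᵥ (coords j) u) i
        ≈⟨ combᵥ-assoc a coords u i ⟨
      combᵥ (λ t → combᵥ a coords t) u i
        ≈⟨ sumF-zero (λ t → trans (*-congʳ (comb≈0 t)) (zeroˡ (u t i))) ⟩
      0# ∎



module CrossProduct {c ℓ : Level} (R : RealField c ℓ) where
  open RealField R hiding (zero)
  open LinAlg R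
  open ℤ-Embedding R
  open OrderedField R
  open Summation R
  open LinearAlgebra R
  open Formulas rawRing public using (cross; dot; det)
  open import Algebra.Properties.Group +-group using (x∙y⁻¹≈ε⇒x≈y)
  open import Relation.Binary.Reasoning.Setoid setoid

  det-cross : ∀ a b c → det a (cross b a) (cross c a) ≈ dot a a * det a b c
  det-cross a b c = solve 9 (λ a₀ a₁ a₂ b₀ b₁ b₂ c₀ c₁ c₂ →
      let a = a₀ ∷ a₁ ∷ a₂ ∷ [] ; b = b₀ ∷ b₁ ∷ b₂ ∷ [] ; c = c₀ ∷ c₁ ∷ c₂ ∷ [] in
      E.det a (E.cross b a) (E.cross c a) := E.dot a a :* E.det a b c)
    refl (a 0F) (a 1F) (a 2F) (b 0F) (b 1F) (b 2F) (c 0F) (c 1F) (c 2F)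

  dot-zeroˡ : ∀ {a} b → a ≈ᵥ zeroᵥ → dot a b ≈ 0#
  dot-zeroˡ b a≈0 = sumF-zero {3} (λ i → trans (*-congʳ (a≈0 i)) (zeroˡ (b i)))

  0<dot-self : ∀ {a} → ¬ a ≈ᵥ zeroᵥ → 0# < dot a a
  0<dot-self {a} a≉0 with nonzero-or-zero a
  ... | inj₁ (j , aⱼ≉0) = sumF-pos (λ i → a i * a i) (λ i → 0≤x² (a i)) j (0<x² aⱼ≉0)
  ... | inj₂ a≈0        = ⊥-elim (a≉0 a≈0)

  -- Cramer's rule, in the form k_j det(u,v,w) = det of the triple with its j-th vector
  -- replaced by the combination Σ k_i (u,v,w)_i, rotated so that it comes first.
  cramer : ∀ k u v w j →
           k j * det u v w ≈ dot (combᵥ k (u ∷ v ∷ w ∷ [])) (cross ((v ∷ w ∷ u ∷ []) j) ((w ∷ u ∷ v ∷ []) j))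
  cramer k u v w 0F = solve 12 (λ k₀ k₁ k₂ u₀ u₁ u₂ v₀ v₁ v₂ w₀ w₁ w₂ →
      let k = k₀ ∷ k₁ ∷ k₂ ∷ [] ; u = u₀ ∷ u₁ ∷ u₂ ∷ [] ; v = v₀ ∷ v₁ ∷ v₂ ∷ [] ; w = w₀ ∷ w₁ ∷ w₂ ∷ [] in
      k₀ :* E.det u v w := E.dot (E.comb₃ k u v w) (E.cross v w))
    refl (k 0F) (k 1F) (k 2F) (u 0F) (u 1F) (u 2F) (v 0F) (v 1F) (v 2F) (w 0F) (w 1F) (w 2F)
  cramer k u v w 1F = solve 12 (λ k₀ k₁ k₂ u₀ u₁ u₂ v₀ v₁ v₂ w₀ w₁ w₂ →
      let k = k₀ ∷ k₁ ∷ k₂ ∷ [] ; u = u₀ ∷ u₁ ∷ u₂ ∷ [] ; v = v₀ ∷ v₁ ∷ v₂ ∷ [] ; w = w₀ ∷ w₁ ∷ w₂ ∷ [] in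
      k₁ :* E.det u v w := E.dot (E.comb₃ k u v w) (E.cross w u))
    refl (k 0F) (k 1F) (k 2F) (u 0F) (u 1F) (u 2F) (v 0F) (v 1F) (v 2F) (w 0F) (w 1F) (w 2F)
  cramer k u v w 2F = solve 12 (λ k₀ k₁ k₂ u₀ u₁ u₂ v₀ v₁ v₂ w₀ w₁ w₂ →
      let k = k₀ ∷ k₁ ∷ k₂ ∷ [] ; u = u₀ ∷ u₁ ∷ u₂ ∷ [] ; v = v₀ ∷ v₁ ∷ v₂ ∷ [] ; w = w₀ ∷ w₁ ∷ w₂ ∷ [] in
      k₂ :* E.det u v w := E.dot (E.comb₃ k u v w) (E.cross u v))
    refl (k 0F) (k 1F) (k 2F) (u 0F) (u 1F) (u 2F) (v 0F) (v 1F) (v 2F) (w 0F) (w 1F) (w 2F)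

  det≉0⇒LinIndep : ∀ {u v w} → ¬ det u v w ≈ 0# → LinIndep (u ∷ v ∷ w ∷ [])
  det≉0⇒LinIndep {u} {v} {w} D≉0 k comb≈0 j =
    *-cancelˡ-≉0 D≉0 (trans (*-comm _ (k j)) (trans (cramer k u v w j)
      (dot-zeroˡ (cross ((v ∷ w ∷ u ∷ []) j) ((w ∷ u ∷ v ∷ []) j)) comb≈0)))

  private
    x*y-z*w≈0⇒x*y≈w*z : ∀ {x y z w} → x * y + - (z * w) ≈ 0# → x * y ≈ w * z
    x*y-z*w≈0⇒x*y≈w*z h = trans (x∙y⁻¹≈ε⇒x≈y _ _ h) (*-comm _ _)

    x*y-z*w≈0⇒z*w≈y*x : ∀ {x y z w} → x * y + - (z * w) ≈ 0# → z * w ≈ y * x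
    x*y-z*w≈0⇒z*w≈y*x h = trans (sym (x∙y⁻¹≈ε⇒x≈y _ _ h)) (*-comm _ _)

    x*1-y*0≈x : ∀ x y → x * 1# + - (y * 0#) ≈ x
    x*1-y*0≈x = solve 2 (λ x y → x :* con (+ 1) :+ :- (y :* con (+ 0)) := x) refl

  cross-proportional : ∀ {a b} → cross a b ≈ᵥ zeroᵥ → ∀ k i → a k * b i ≈ b k * a i
  cross-proportional a×b≈0 0F 0F = *-comm _ _
  cross-proportional a×b≈0 0F 1F = x*y-z*w≈0⇒x*y≈w*z (a×b≈0 2F)
  cross-proportional a×b≈0 0F 2F = x*y-z*w≈0⇒z*w≈y*x (a×b≈0 1F)
  cross-proportional a×b≈0 1F 0F = x*y-z*w≈0⇒z*w≈y*x (a×b≈0 2F)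
  cross-proportional a×b≈0 1F 1F = *-comm _ _
  cross-proportional a×b≈0 1F 2F = x*y-z*w≈0⇒x*y≈w*z (a×b≈0 0F)
  cross-proportional a×b≈0 2F 0F = x*y-z*w≈0⇒x*y≈w*z (a×b≈0 1F)
  cross-proportional a×b≈0 2F 1F = x*y-z*w≈0⇒z*w≈y*x (a×b≈0 0F)
  cross-proportional a×b≈0 2F 2F = *-comm _ _

  LinIndep⇒cross≉0 : ∀ {f : Fin 2 → Vector 3} → LinIndep f → ¬ cross (f 0F) (f 1F) ≈ᵥ zeroᵥ
  LinIndep⇒cross≉0 {f} ind a×b≈0 with nonzero-or-zero (f 0F)
  ... | inj₂ a≈0        = LinIndep⇒≉0 {f = f} ind 0F a≈0
  ... | inj₁ (k , aₖ≉0) = aₖ≉0 (ind (- b k ∷ a k ∷ []) comb≈0 1F)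
    where
    a = f 0F
    b = f 1F
    comb≈0 : combᵥ (- b k ∷ a k ∷ []) f ≈ᵥ zeroᵥ
    comb≈0 i = begin
      - b k * a i + (a k * b i + 0#) ≈⟨ +-congˡ (+-identityʳ _) ⟩
      - b k * a i + a k * b i        ≈⟨ +-congˡ (cross-proportional a×b≈0 k i) ⟩
      - b k * a i + b k * a i        ≈⟨ solve 2 (λ x y → :- x :* y :+ x :* y := con (+ 0)) refl (b k) (a i) ⟩
      0#                             ∎

  cross-nonzero : ∀ {n} → ¬ n ≈ᵥ zeroᵥ → ∃[ q ] ¬ cross n q ≈ᵥ zeroᵥ
  cross-nonzero {n} n≉0 with nonzero-or-zero n
  ... | inj₂ n≈0         = ⊥-elim (n≉0 n≈0)
  ... | inj₁ (0F , n₀≉0) = 0# ∷ 1# ∷ 0# ∷ [] , λ h → n₀≉0 (trans (sym (x*1-y*0≈x _ _)) (h 2F))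
  ... | inj₁ (1F , n₁≉0) = 0# ∷ 0# ∷ 1# ∷ [] , λ h → n₁≉0 (trans (sym (x*1-y*0≈x _ _)) (h 0F))
  ... | inj₁ (2F , n₂≉0) = 1# ∷ 0# ∷ 0# ∷ [] , λ h → n₂≉0 (trans (sym (x*1-y*0≈x _ _)) (h 1F))

module ExampleSpace {c ℓ : Level} (R : RealField c ℓ) where
  open RealField R hiding (zero)
  open LinAlg R
  open ℤ-Embedding R
  open OrderedField R
  open Summation R
  open LinearAlgebra R
  open CrossProduct R
  open Formulas rawRing using (entry)
  open Formulas rawRing public using (𝔹; params; dual; ext; kernelVector)
  open ℤ-Matrices using (𝔹ℤ)
  open import Algebra.Properties.Ring ring using (-‿distribʳ-*)
  open import Algebra.Properties.Group +-group using (ε⁻¹≈ε)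
  open import Relation.Binary.Reasoning.Setoid setoid

  entry-linear : ∀ {k} (a : Fin k → Carrier) (q : Fin k → Fin 7 → Carrier) e →
                 sumF (λ t → a t * entry (q t) e) ≈ entry (λ s → sumF (λ t → a t * q t s)) e
  entry-linear a q 0ₑ     = sumF-zero (λ t → zeroʳ (a t))
  entry-linear a q (+ₑ s) = refl
  entry-linear a q (-ₑ s) = begin
    sumF (λ t → a t * - q t s)      ≈⟨ sumF-cong (λ t → -‿distribʳ-* (a t) (q t s)) ⟨
    sumF (λ t → - (a t * q t s))    ≈⟨ -‿distrib-sumF (λ t → a t * q t s) ⟨
    - sumF (λ t → a t * q t s)      ∎

  𝔹-linear : ∀ {k} (a : Fin k → Carrier) (q : Fin k → Fin 7 → Carrier) →
             combₘ a (λ t → 𝔹 (q t)) ≈ₘ 𝔹 (λ s → sumF (λ t → a t * q t s))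
  𝔹-linear a q i j = entry-linear a q (shape i j)

  𝔹-cong : ∀ {p p′} → (∀ s → p s ≈ p′ s) → 𝔹 p ≈ₘ 𝔹 p′
  𝔹-cong p≈p′ i j with shape i j
  ... | 0ₑ   = refl
  ... | +ₑ s = p≈p′ s
  ... | -ₑ s = -‿cong (p≈p′ s)

  ι-𝔹 : ∀ (q : Fin 7 → ℤ) i j → ι (𝔹ℤ q i j) ≈ 𝔹 (λ s → ι (q s)) i j
  ι-𝔹 q i j with shape i j
  ... | 0ₑ   = refl
  ... | +ₑ s = refl
  ... | -ₑ s = ι-neg (q s)

  𝔹-column : ∀ a x → (𝔹 (params a zeroᵥ) ·ᵥ x) ≈ᵥ (λ i → x 0F * a i)
  𝔹-column a x 0F = solve 8 (λ a₀ a₁ a₂ a₃ x₀ x₁ x₂ x₃ →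
      let a = a₀ ∷ a₁ ∷ a₂ ∷ a₃ ∷ [] ; x = x₀ ∷ x₁ ∷ x₂ ∷ x₃ ∷ [] in
      (E.𝔹 (E.params a (λ _ → con (+ 0))) E.·₄ x) 0F := x₀ :* a 0F)
    refl (a 0F) (a 1F) (a 2F) (a 3F) (x 0F) (x 1F) (x 2F) (x 3F)
  𝔹-column a x 1F = solve 8 (λ a₀ a₁ a₂ a₃ x₀ x₁ x₂ x₃ →
      let a = a₀ ∷ a₁ ∷ a₂ ∷ a₃ ∷ [] ; x = x₀ ∷ x₁ ∷ x₂ ∷ x₃ ∷ [] in
      (E.𝔹 (E.params a (λ _ → con (+ 0))) E.·₄ x) 1F := x₀ :* a 1F)
    refl (a 0F) (a 1F) (a 2F) (a 3F) (x 0F) (x 1F) (x 2F) (x 3F)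
  𝔹-column a x 2F = solve 8 (λ a₀ a₁ a₂ a₃ x₀ x₁ x₂ x₃ →
      let a = a₀ ∷ a₁ ∷ a₂ ∷ a₃ ∷ [] ; x = x₀ ∷ x₁ ∷ x₂ ∷ x₃ ∷ [] in
      (E.𝔹 (E.params a (λ _ → con (+ 0))) E.·₄ x) 2F := x₀ :* a 2F)
    refl (a 0F) (a 1F) (a 2F) (a 3F) (x 0F) (x 1F) (x 2F) (x 3F)
  𝔹-column a x 3F = solve 8 (λ a₀ a₁ a₂ a₃ x₀ x₁ x₂ x₃ →
      let a = a₀ ∷ a₁ ∷ a₂ ∷ a₃ ∷ [] ; x = x₀ ∷ x₁ ∷ x₂ ∷ x₃ ∷ [] in
      (E.𝔹 (E.params a (λ _ → con (+ 0))) E.·₄ x) 3F := x₀ :* a 3F)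
    refl (a 0F) (a 1F) (a 2F) (a 3F) (x 0F) (x 1F) (x 2F) (x 3F)

  𝔹-hyperplane : ∀ q x → (𝔹 (params zeroᵥ q) ·ᵥ x) ≈ᵥ ext (cross (dual x) q)
  𝔹-hyperplane q x 0F = solve 7 (λ q₀ q₁ q₂ x₀ x₁ x₂ x₃ →
      let q = q₀ ∷ q₁ ∷ q₂ ∷ [] ; x = x₀ ∷ x₁ ∷ x₂ ∷ x₃ ∷ [] in
      (E.𝔹 (E.params (λ _ → con (+ 0)) q) E.·₄ x) 0F := E.ext (E.cross (E.dual x) q) 0F)
    refl (q 0F) (q 1F) (q 2F) (x 0F) (x 1F) (x 2F) (x 3F)
  𝔹-hyperplane q x 1F = solve 7 (λ q₀ q₁ q₂ x₀ x₁ x₂ x₃ →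
      let q = q₀ ∷ q₁ ∷ q₂ ∷ [] ; x = x₀ ∷ x₁ ∷ x₂ ∷ x₃ ∷ [] in
      (E.𝔹 (E.params (λ _ → con (+ 0)) q) E.·₄ x) 1F := E.ext (E.cross (E.dual x) q) 1F)
    refl (q 0F) (q 1F) (q 2F) (x 0F) (x 1F) (x 2F) (x 3F)
  𝔹-hyperplane q x 2F = solve 7 (λ q₀ q₁ q₂ x₀ x₁ x₂ x₃ →
      let q = q₀ ∷ q₁ ∷ q₂ ∷ [] ; x = x₀ ∷ x₁ ∷ x₂ ∷ x₃ ∷ [] in
      (E.𝔹 (E.params (λ _ → con (+ 0)) q) E.·₄ x) 2F := E.ext (E.cross (E.dual x) q) 2F)
    refl (q 0F) (q 1F) (q 2F) (x 0F) (x 1F) (x 2F) (x 3F)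
  𝔹-hyperplane q x 3F = solve 7 (λ q₀ q₁ q₂ x₀ x₁ x₂ x₃ →
      let q = q₀ ∷ q₁ ∷ q₂ ∷ [] ; x = x₀ ∷ x₁ ∷ x₂ ∷ x₃ ∷ [] in
      (E.𝔹 (E.params (λ _ → con (+ 0)) q) E.·₄ x) 3F := E.ext (E.cross (E.dual x) q) 3F)
    refl (q 0F) (q 1F) (q 2F) (x 0F) (x 1F) (x 2F) (x 3F)

  𝔹-kernelVector : ∀ p → (𝔹 p ·ᵥ kernelVector p) ≈ᵥ zeroᵥ
  𝔹-kernelVector p 0F = solve 7 (λ p₀ p₁ p₂ p₃ p₄ p₅ p₆ →
      let p = p₀ ∷ p₁ ∷ p₂ ∷ p₃ ∷ p₄ ∷ p₅ ∷ p₆ ∷ [] in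
      (E.𝔹 p E.·₄ E.kernelVector p) 0F := con (+ 0))
    refl (p 0F) (p 1F) (p 2F) (p 3F) (p 4F) (p 5F) (p 6F)
  𝔹-kernelVector p 1F = solve 7 (λ p₀ p₁ p₂ p₃ p₄ p₅ p₆ →
      let p = p₀ ∷ p₁ ∷ p₂ ∷ p₃ ∷ p₄ ∷ p₅ ∷ p₆ ∷ [] in
      (E.𝔹 p E.·₄ E.kernelVector p) 1F := con (+ 0))
    refl (p 0F) (p 1F) (p 2F) (p 3F) (p 4F) (p 5F) (p 6F)
  𝔹-kernelVector p 2F = solve 7 (λ p₀ p₁ p₂ p₃ p₄ p₅ p₆ →
      let p = p₀ ∷ p₁ ∷ p₂ ∷ p₃ ∷ p₄ ∷ p₅ ∷ p₆ ∷ [] in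
      (E.𝔹 p E.·₄ E.kernelVector p) 2F := con (+ 0))
    refl (p 0F) (p 1F) (p 2F) (p 3F) (p 4F) (p 5F) (p 6F)
  𝔹-kernelVector p 3F = solve 7 (λ p₀ p₁ p₂ p₃ p₄ p₅ p₆ →
      let p = p₀ ∷ p₁ ∷ p₂ ∷ p₃ ∷ p₄ ∷ p₅ ∷ p₆ ∷ [] in
      (E.𝔹 p E.·₄ E.kernelVector p) 3F := con (+ 0))
    refl (p 0F) (p 1F) (p 2F) (p 3F) (p 4F) (p 5F) (p 6F)

  𝔹-e₁ : ∀ p → (𝔹 p ·ᵥ identity 1F) ≈ᵥ (- p 5F ∷ p 4F ∷ 0# ∷ 0# ∷ [])
  𝔹-e₁ p 0F = solve 7 (λ p₀ p₁ p₂ p₃ p₄ p₅ p₆ →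
      let p = p₀ ∷ p₁ ∷ p₂ ∷ p₃ ∷ p₄ ∷ p₅ ∷ p₆ ∷ [] ; e₁ = con (+ 0) ∷ con (+ 1) ∷ con (+ 0) ∷ con (+ 0) ∷ [] in
      (E.𝔹 p E.·₄ e₁) 0F := (:- p₅))
    refl (p 0F) (p 1F) (p 2F) (p 3F) (p 4F) (p 5F) (p 6F)
  𝔹-e₁ p 1F = solve 7 (λ p₀ p₁ p₂ p₃ p₄ p₅ p₆ →
      let p = p₀ ∷ p₁ ∷ p₂ ∷ p₃ ∷ p₄ ∷ p₅ ∷ p₆ ∷ [] ; e₁ = con (+ 0) ∷ con (+ 1) ∷ con (+ 0) ∷ con (+ 0) ∷ [] in
      (E.𝔹 p E.·₄ e₁) 1F := p₄)
    refl (p 0F) (p 1F) (p 2F) (p 3F) (p 4F) (p 5F) (p 6F)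
  𝔹-e₁ p 2F = solve 7 (λ p₀ p₁ p₂ p₃ p₄ p₅ p₆ →
      let p = p₀ ∷ p₁ ∷ p₂ ∷ p₃ ∷ p₄ ∷ p₅ ∷ p₆ ∷ [] ; e₁ = con (+ 0) ∷ con (+ 1) ∷ con (+ 0) ∷ con (+ 0) ∷ [] in
      (E.𝔹 p E.·₄ e₁) 2F := con (+ 0))
    refl (p 0F) (p 1F) (p 2F) (p 3F) (p 4F) (p 5F) (p 6F)
  𝔹-e₁ p 3F = solve 7 (λ p₀ p₁ p₂ p₃ p₄ p₅ p₆ →
      let p = p₀ ∷ p₁ ∷ p₂ ∷ p₃ ∷ p₄ ∷ p₅ ∷ p₆ ∷ [] ; e₁ = con (+ 0) ∷ con (+ 1) ∷ con (+ 0) ∷ con (+ 0) ∷ [] in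
      (E.𝔹 p E.·₄ e₁) 3F := con (+ 0))
    refl (p 0F) (p 1F) (p 2F) (p 3F) (p 4F) (p 5F) (p 6F)

  𝔹-singular : ∀ p → ¬ TrivialKernel (𝔹 p)
  𝔹-singular p ker = 1≉0 (ker (identity 1F) 𝔹e₁≈0 1F)
    where
    k≈0 = ker (kernelVector p) (𝔹-kernelVector p)
    𝔹e₁≈0 : (𝔹 p ·ᵥ identity 1F) ≈ᵥ zeroᵥ
    𝔹e₁≈0 0F = trans (𝔹-e₁ p 0F) (trans (-‿cong (k≈0 2F)) ε⁻¹≈ε)
    𝔹e₁≈0 1F = trans (𝔹-e₁ p 1F) (-x≈0⇒x≈0 (k≈0 3F))
    𝔹e₁≈0 2F = 𝔹-e₁ p 2F
    𝔹e₁≈0 3F = 𝔹-e₁ p 3F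

  ext-≉0 : ∀ {v} → ¬ v ≈ᵥ zeroᵥ → ¬ ext v ≈ᵥ zeroᵥ
  ext-≉0 v≉0 ext≈0 = v≉0 λ { 0F → ext≈0 0F ; 1F → ext≈0 1F ; 2F → ext≈0 2F }

  LinIndep-ext : ∀ {d} {f : Fin d → Vector 3} → LinIndep f → LinIndep (λ j → ext (f j))
  LinIndep-ext ind a comb≈0 = ind a λ { 0F → comb≈0 0F ; 1F → comb≈0 1F ; 2F → comb≈0 2F }

  dual-≉0 : ∀ {x} → x 0F ≈ 0# → ¬ x ≈ᵥ zeroᵥ → ¬ dual x ≈ᵥ zeroᵥ
  dual-≉0 x₀≈0 x≉0 dual≈0 = x≉0 λ
    { 0F → x₀≈0 ; 1F → dual≈0 2F ; 2F → -x≈0⇒x≈0 (dual≈0 1F) ; 3F → dual≈0 0F }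

  LinIndep-dual : ∀ {d} {f : Fin d → Vector 4} →
                  (∀ j → f j 0F ≈ 0#) → LinIndep f → LinIndep (λ j → dual (f j))
  LinIndep-dual {f = f} f₀≈0 ind a comb≈0 = ind a λ
    { 0F → sumF-zero (λ j → trans (*-congˡ (f₀≈0 j)) (zeroʳ (a j)))
    ; 1F → comb≈0 2F
    ; 2F → -x≈0⇒x≈0 (begin
        - sumF (λ j → a j * f j 2F)      ≈⟨ -‿distrib-sumF (λ j → a j * f j 2F) ⟩
        sumF (λ j → - (a j * f j 2F))    ≈⟨ sumF-cong (λ j → -‿distribʳ-* (a j) (f j 2F)) ⟩
        sumF (λ j → a j * - f j 2F)      ≈⟨ comb≈0 1F ⟩
        0#                               ∎)
    ; 3F → comb≈0 0F }

module NotEdmondsRado {c ℓ : Level} (R : RealField c ℓ) where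
  open RealField R hiding (zero)
  open LinAlg R
  open OrderedField R
  open LinearAlgebra R
  open CrossProduct R
  open ExampleSpace R

  SpanOf : ∀ {k} → (Fin k → Matrix 4) → Matrix 4 → Set (c ⊔ ℓ)
  SpanOf gens L = (∀ B → MatSpace gens B → ∃[ p ] B ≈ₘ (L ·ₘ 𝔹 p))
                × (∀ p → MatSpace gens (L ·ₘ 𝔹 p))

  module _ {k} {gens : Fin k → Matrix 4} {L : Matrix 4} (ker-L : TrivialKernel L) (span : SpanOf gens L) where

    no-nonsingular : ¬ (∃[ B ] (MatSpace gens B × Nonsingular B))
    no-nonsingular (B , B∈ , B-nonsingular) with proj₁ span B B∈
    ... | p , B≈L𝔹 = 𝔹-singular p (TrivialKernel-·ₘ {A = L} {B = 𝔹 p}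
      (TrivialKernel-resp {B = L ·ₘ 𝔹 p} B≈L𝔹 (Nonsingular⇒TrivialKernel {B = B} B-nonsingular)))

    module _ {l} (u : Fin l → Vector 4) {e} (b : Fin e → Vector 4)
             (b-spans : ∀ v → Image gens (SubSp u) v → Span (FamSet b) v) where

      image∈ : ∀ p {x} → SubSp u x → Image gens (SubSp u) (L ·ᵥ (𝔹 p ·ᵥ x))
      image∈ p {x} x∈U = ∈⇒Span {S = λ v → ∃[ B ] ∃[ y ] (MatSpace gens B × SubSp u y × v ≈ᵥ (B ·ᵥ y))}
        (L ·ₘ 𝔹 p , x , proj₂ span p , x∈U , λ i → sym (·ₘ-·ᵥ-assoc L (𝔹 p) x i))

      image-bound : ∀ {r} (ps : Fin r → Fin 7 → Carrier) (xs : Fin r → Vector 4) → (∀ t → SubSp u (xs t)) →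
                    LinIndep (λ t → 𝔹 (ps t) ·ᵥ xs t) → r ≤ℕ e
      image-bound ps xs xs∈U ind = LinIndep-Span-≤ b (λ t → L ·ᵥ (𝔹 (ps t) ·ᵥ xs t))
        (λ t → b-spans (L ·ᵥ (𝔹 (ps t) ·ᵥ xs t)) (image∈ (ps t) (xs∈U t)))
        (LinIndep-map {A = L} {f = λ t → 𝔹 (ps t) ·ᵥ xs t} ker-L ind)

      hyperplane-bound : ∀ {d} (x : Fin d → Vector 4) → (∀ j → SubSp u (x j)) → LinIndep x →
                         (∀ j → x j 0F ≈ 0#) → d ≤ℕ e
      hyperplane-bound {0} x x∈U ind x₀≈0 = z≤n
      hyperplane-bound {1} x x∈U ind x₀≈0 with cross-nonzero (dual-≉0 (x₀≈0 0F) (LinIndep⇒≉0 {f = x} ind 0F))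
      ... | q , image≉0 = image-bound (λ _ → params zeroᵥ q) (λ _ → x 0F) (λ _ → x∈U 0F)
        (LinIndep-resp {g = λ _ → 𝔹 (params zeroᵥ q) ·ᵥ x 0F} (λ _ i → sym (𝔹-hyperplane q (x 0F) i))
                       (LinIndep-singleton (ext-≉0 {cross (dual (x 0F)) q} image≉0)))
      hyperplane-bound {suc (suc d)} x x∈U ind x₀≈0 = ℕ.≤-trans d≤3 3≤e
        where
        n = dual (x 0F)
        n′ = dual (x 1F)
        m = cross n n′
        m≉0 : ¬ m ≈ᵥ zeroᵥ
        m≉0 = LinIndep⇒cross≉0 {f = λ j → dual (x (j ↑ˡ d))}
          (LinIndep-dual {f = λ j → x (j ↑ˡ d)} (λ j → x₀≈0 (j ↑ˡ d)) (LinIndep-first₂ {f = x} ind))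
        D≉0 : ¬ det m (cross n m) (cross n′ m) ≈ 0#
        D≉0 D≈0 = 0<⇒≉0 (*-pos (0<dot-self m≉0) (0<dot-self m≉0)) (trans (sym (det-cross m n n′)) D≈0)
        d≤3 : suc (suc d) ≤ℕ 3
        d≤3 = LinIndep-Span-≤ (identity ∘ suc) x
          (λ j → combᵥ∈Span (identity ∘ suc) (x j ∘ suc) (hyperplane-combᵥ (x₀≈0 j))) ind
        3≤e : 3 ≤ℕ e
        3≤e = image-bound ps xs (λ { 0F → x∈U 0F ; 1F → x∈U 0F ; 2F → x∈U 1F })
          (LinIndep-resp {f = λ t → ext ((m ∷ cross n m ∷ cross n′ m ∷ []) t)} {g = λ t → 𝔹 (ps t) ·ᵥ xs t}
            (λ { 0F i → sym (𝔹-hyperplane n′ (x 0F) i)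
               ; 1F i → sym (𝔹-hyperplane m (x 0F) i)
               ; 2F i → sym (𝔹-hyperplane m (x 1F) i) })
            (LinIndep-ext {f = m ∷ cross n m ∷ cross n′ m ∷ []} (det≉0⇒LinIndep D≉0)))
          where
          ps = params zeroᵥ n′ ∷ params zeroᵥ m ∷ params zeroᵥ m ∷ []
          xs = x 0F ∷ x 0F ∷ x 1F ∷ []

      dim-bound : ∀ {d} (x : Fin d → Vector 4) → (∀ j → SubSp u (x j)) → LinIndep x → d ≤ℕ e
      dim-bound x x∈U ind with nonzero-or-zero (λ j → x j 0F)
      ... | inj₂ x₀≈0        = hyperplane-bound x x∈U ind x₀≈0
      ... | inj₁ (j , x₀≉0)  = ℕ.≤-trans (LinIndep-Span-≤ identity x (λ j → identity-spans (x j)) ind) 4≤e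
        where
        4≤e : 4 ≤ℕ e
        4≤e = image-bound (λ k → params (identity k) zeroᵥ) (λ _ → x j) (λ _ → x∈U j)
          (LinIndep-resp {g = λ k → 𝔹 (params (identity k) zeroᵥ) ·ᵥ x j}
                         (λ k i → sym (𝔹-column (identity k) (x j) i))
                         (LinIndep-scale {f = identity} x₀≉0 identity-LinIndep))

    ¬EdmondsRado : ¬ EdmondsRado gens
    ¬EdmondsRado (inj₁ nonsingular) = no-nonsingular nonsingular
    ¬EdmondsRado (inj₂ (_ , u , d , e , (x , x∈U , ind , _) , (b , _ , _ , b-spans) , e<d)) =
      ℕ.<⇒≱ e<d (dim-bound u b b-spans x x∈U ind)

module Generators {c ℓ : Level} (R : RealField c ℓ) where
  open RealField R hiding (zero)
  open LinAlg R
  open ℤ-Embedding R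
  open OrderedField R
  open Summation R
  open LinearAlgebra R
  open ExampleSpace R
  open NotEdmondsRado R
  open ℤ-Matrices
  open import Relation.Binary.Reasoning.Setoid setoid

  ιᴹ : ∀ {m n} → (Fin m → Fin n → ℤ) → Fin m → Fin n → Carrier
  ιᴹ A i j = ι (A i j)

  ι-sum : ∀ {k} (f : Fin k → ℤ) → ι (sum f) ≈ sumF (λ i → ι (f i))
  ι-sum {zero}  f = refl
  ι-sum {suc k} f = trans (ι-+ (f zero) (sum (f ∘ suc))) (+-congˡ (ι-sum (f ∘ suc)))

  ι-⊗ : ∀ {m k n} (A : Fin m → Fin k → ℤ) (B : Fin k → Fin n → ℤ) i j →
        ι ((A ⊗ B) i j) ≈ sumF (λ l → ι (A i l) * ι (B l j))
  ι-⊗ A B i j = trans (ι-sum (λ l → A i l ℤ.* B l j)) (sumF-cong (λ l → ι-* (A i l) (B l j)))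

  ι-idℤ : ∀ {n} (i j : Fin n) → ι (idℤ i j) ≈ identity i j
  ι-idℤ i j with i ≟ j
  ... | yes _ = refl
  ... | no  _ = refl

  SpanOf-basis : ∀ (C D : Fin 7 → Fin 7 → ℤ) → (∀ u s → (D ⊗ C) u s ≡ idℤ u s) →
                 ∀ L (gens : Fin 7 → Matrix 4) → (∀ t → gens t ≈ₘ (L ·ₘ 𝔹 (ιᴹ C t))) → SpanOf gens L
  SpanOf-basis C D DC≡I L gens gens≈ = spanned , spanning
    where
    coefficients : (Fin 7 → Carrier) → Fin 7 → Carrier
    coefficients a s = sumF (λ t → a t * ι (C t s))

    combₘ-gens : ∀ a → combₘ a gens ≈ₘ (L ·ₘ 𝔹 (coefficients a))
    combₘ-gens a i j = begin
      combₘ a gens i j                              ≈⟨ combₘ-congʳ a gens≈ i j ⟩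
      combₘ a (λ t → L ·ₘ 𝔹 (ιᴹ C t)) i j          ≈⟨ ·ₘ-combₘ L a (λ t → 𝔹 (ιᴹ C t)) i j ⟨
      (L ·ₘ combₘ a (λ t → 𝔹 (ιᴹ C t))) i j        ≈⟨ ·ₘ-congʳ L (𝔹-linear a (ιᴹ C)) i j ⟩
      (L ·ₘ 𝔹 (coefficients a)) i j                 ∎

    spanned : ∀ B → MatSpace gens B → ∃[ p ] B ≈ₘ (L ·ₘ 𝔹 p)
    spanned B (a , B≈) = coefficients a , λ i j → trans (B≈ i j) (combₘ-gens a i j)

    coefficients-inverse : ∀ p s → coefficients (λ t → sumF (λ u → p u * ι (D u t))) s ≈ p s
    coefficients-inverse p s = begin
      combᵥ (λ t → sumF (λ u → p u * ι (D u t))) (ιᴹ C) s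
        ≈⟨ combᵥ-assoc p (ιᴹ D) (ιᴹ C) s ⟩
      sumF (λ u → p u * sumF (λ t → ι (D u t) * ι (C t s)))
        ≈⟨ sumF-cong (λ u → *-congˡ {p u} (sym (ι-⊗ D C u s))) ⟩
      sumF (λ u → p u * ι ((D ⊗ C) u s))
        ≈⟨ sumF-cong (λ u → *-congˡ {p u} (trans (reflexive (≡.cong ι (DC≡I u s))) (ι-idℤ u s))) ⟩
      sumF (λ u → p u * identity u s)
        ≈⟨ sumF-identityʳ s p ⟩
      p s ∎

    spanning : ∀ p → MatSpace gens (L ·ₘ 𝔹 p)
    spanning p = a , λ i j → sym (trans (combₘ-gens a i j) (·ₘ-congʳ L (𝔹-cong (coefficients-inverse p)) i j))
      where a = λ t → sumF (λ u → p u * ι (D u t))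

  gens₁ : Fin 7 → Matrix 4
  gens₁ t = 𝔹 (ιᴹ C₁ t)

  gens₁-idempotent : ∀ t → Idempotent (gens₁ t)
  gens₁-idempotent t i j = begin
    (gens₁ t ·ₘ gens₁ t) i j
      ≈⟨ sumF-cong (λ l → *-cong (sym (ι-𝔹 (C₁ t) i l)) (sym (ι-𝔹 (C₁ t) l j))) ⟩
    sumF (λ l → ι (P i l) * ι (P l j))
      ≈⟨ ι-⊗ P P i j ⟨
    ι ((P ⊗ P) i j)
      ≡⟨ ≡.cong ι (C₁-idempotent t i j) ⟩
    ι (P i j)
      ≈⟨ ι-𝔹 (C₁ t) i j ⟩
    gens₁ t i j ∎
    where P = 𝔹ℤ (C₁ t)

  gens₁-¬EdmondsRado : ¬ EdmondsRado gens₁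
  gens₁-¬EdmondsRado = ¬EdmondsRado {gens = gens₁} {L = identity} identity-TrivialKernel
    (SpanOf-basis C₁ D₁ D₁C₁≡I identity gens₁ (λ t i j → sym (identity-·ₘ (gens₁ t) i j)))

  L : Matrix 4
  L = ιᴹ Lℤ

  -- L⁻¹ = I - (2/9) J, cleared of denominators.
  9v≈9Lv-2JLv : ∀ v i → ι (+ 9) * v i ≈ ι (+ 9) * (L ·ᵥ v) i + - (ι (+ 2) * sumF (L ·ᵥ v))
  9v≈9Lv-2JLv v 0F = solve 4 (λ v₀ v₁ v₂ v₃ →
      let v = v₀ ∷ v₁ ∷ v₂ ∷ v₃ ∷ [] ; Lv = (λ i j → con (Lℤ i j)) E.·₄ v in
      con (+ 9) :* v 0F := con (+ 9) :* Lv 0F :+ :- (con (+ 2) :* E.sum₄ Lv))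
    refl (v 0F) (v 1F) (v 2F) (v 3F)
  9v≈9Lv-2JLv v 1F = solve 4 (λ v₀ v₁ v₂ v₃ →
      let v = v₀ ∷ v₁ ∷ v₂ ∷ v₃ ∷ [] ; Lv = (λ i j → con (Lℤ i j)) E.·₄ v in
      con (+ 9) :* v 1F := con (+ 9) :* Lv 1F :+ :- (con (+ 2) :* E.sum₄ Lv))
    refl (v 0F) (v 1F) (v 2F) (v 3F)
  9v≈9Lv-2JLv v 2F = solve 4 (λ v₀ v₁ v₂ v₃ →
      let v = v₀ ∷ v₁ ∷ v₂ ∷ v₃ ∷ [] ; Lv = (λ i j → con (Lℤ i j)) E.·₄ v in
      con (+ 9) :* v 2F := con (+ 9) :* Lv 2F :+ :- (con (+ 2) :* E.sum₄ Lv))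
    refl (v 0F) (v 1F) (v 2F) (v 3F)
  9v≈9Lv-2JLv v 3F = solve 4 (λ v₀ v₁ v₂ v₃ →
      let v = v₀ ∷ v₁ ∷ v₂ ∷ v₃ ∷ [] ; Lv = (λ i j → con (Lℤ i j)) E.·₄ v in
      con (+ 9) :* v 3F := con (+ 9) :* Lv 3F :+ :- (con (+ 2) :* E.sum₄ Lv))
    refl (v 0F) (v 1F) (v 2F) (v 3F)

  L-TrivialKernel : TrivialKernel L
  L-TrivialKernel v Lv≈0 i = *-cancelˡ-≉0 (0<⇒≉0 (0<ι {+ 9} (ℤ.+<+ (s≤s z≤n)))) (begin
    ι (+ 9) * v i
      ≈⟨ 9v≈9Lv-2JLv v i ⟩
    ι (+ 9) * (L ·ᵥ v) i + - (ι (+ 2) * sumF (L ·ᵥ v))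
      ≈⟨ +-cong (*-congˡ (Lv≈0 i)) (-‿cong (*-congˡ (sumF-zero {f = L ·ᵥ v} Lv≈0))) ⟩
    ι (+ 9) * 0# + - (ι (+ 2) * 0#)
      ≈⟨ solve 0 (con (+ 9) :* con (+ 0) :+ :- (con (+ 2) :* con (+ 0)) := con (+ 0)) refl ⟩
    0# ∎)

  gens₂ : Fin 7 → Matrix 4
  gens₂ t = L ·ₘ 𝔹 (ιᴹ C₂ t)

  gens₂-positive : ∀ t → Positive (gens₂ t)
  gens₂-positive t i j = <-resp-≈ refl L𝔹≈ (0<ι (C₂-positive t i j))
    where
    L𝔹≈ : ι ((Lℤ ⊗ 𝔹ℤ (C₂ t)) i j) ≈ gens₂ t i j
    L𝔹≈ = trans (ι-⊗ Lℤ (𝔹ℤ (C₂ t)) i j)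
                (sumF-cong (λ l → *-congˡ {ι (Lℤ i l)} (ι-𝔹 (C₂ t) l j)))

  gens₂-¬EdmondsRado : ¬ EdmondsRado gens₂
  gens₂-¬EdmondsRado = ¬EdmondsRado {gens = gens₂} {L = L} L-TrivialKernel
    (SpanOf-basis C₂ D₂ D₂C₂≡I L gens₂ (λ t i j → refl))

proposition5 : ∀ {c ℓ : Level} (R : RealField c ℓ) → let open LinAlg R in
    (∃[ n ] ∃[ k ] Σ (Fin k → Matrix n) λ gens →
    (∀ i → Idempotent (gens i)) × ¬ EdmondsRado gens)
    × (∃[ n ] ∃[ k ] Σ (Fin k → Matrix n) λ gens →
    (∀ i → Positive (gens i)) × ¬ EdmondsRado gens)
proposition5 R = (4 , 7 , gens₁ , gens₁-idempotent , gens₁-¬EdmondsRado)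
               , (4 , 7 , gens₂ , gens₂-positive , gens₂-¬EdmondsRado)
  where open Generators R
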